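{- For any $1<\xi\leq m$ and $a,a'\in \{0,\ldots,\gamma_{m-1}^*-1\}$, if $a-\pi_{\xi}(a)=a'-\pi_{\xi}(a')$, then (1) $\pi_{\xi}(a)-\pi_{\xi-1}(a)=\pi_{\xi}(a')-\pi_{\xi-1}(a')$; (2) $a-\pi_{\xi-1}(a)=a'-\pi_{\xi-1}(a')$.
   Context: Fix $m\geq 3$. Let $\gamma_0^*:=4m$ and $\gamma_i^*:=4(m-i)\gamma_{i-1}^*$ for $0<i<m$. For $0\leq j\leq i\leq m-1$ let $\beta_{j}^{i}:=\gamma_i^*/\gamma_j^*$. For $x\in\{0,\ldots,\gamma_{m-1}^*-1\}$ and $1\leq i\leq m$ let $[x]_i:=\lfloor x/\beta_{m-i}^{m-1}\rfloor$ and $\pi_i(x):=[x]_i\,\beta_{m-i}^{m-1}+\frac{1}{2}\sum_{1<\ell\leq i}\beta_{m-\ell}^{m-1}$ (written in the paper with a special double-parenthesis notation; it is the first coordinate of the projection of a vertex with first coordinate $x$ into the $i$-th abstraction). -}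

module Defs where

open import Data.Nat using (ℕ; zero; suc; _+_; _*_; _∸_)
import Data.Nat.DivMod as ND
open import Data.Integer using (+_)
open import Data.Rational using (ℚ; ½; _/_) renaming (_+_ to _+ℚ_; _*_ to _*ℚ_)

toℚ : ℕ → ℚ
toℚ n = (+ n) / 1

γ* : ℕ → ℕ → ℕ
γ* m zero = 4 * m
γ* m (suc i) = 4 * (m ∸ suc i) * γ* m i

prodFrom : ℕ → ℕ → ℕ → ℕ
prodFrom m j zero = 1
prodFrom m j (suc n) = 4 * (m ∸ (j + suc n)) * prodFrom m j n

-- β^i_j := γ*_i / γ*_j  (for j ≤ i), written as the exact quotient
-- ∏_{k=j+1}^{i} 4(m-k)
β : ℕ → ℕ → ℕ → ℕ
β m j i = prodFrom m j (i ∸ j)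

-- floor division, total (divisor 0 never occurs in our uses)
divN : ℕ → ℕ → ℕ
divN x zero = 0
divN x (suc d) = ND._/_ x (suc d)

box : ℕ → ℕ → ℕ → ℕ
box m i x = divN x (β m (m ∸ i) (m ∸ 1))

bsum : ℕ → ℕ → ℕ
bsum m zero = 0
bsum m (suc zero) = 0
bsum m (suc (suc k)) = bsum m (suc k) + β m (m ∸ suc (suc k)) (m ∸ 1)

π : ℕ → ℕ → ℕ → ℚ
π m i x = toℚ (box m i x * β m (m ∸ i) (m ∸ 1)) +ℚ (½ *ℚ toℚ (bsum m i))

-- Writing x = ⌊x/D⌋·D + (x mod D) with D = β^{m-1}_{m-ξ}, the offset a − π_ξ(a) is
-- (a mod D) minus a constant depending only on ξ, so the hypothesis says that a and a'
-- have the same residue modulo β^{m-1}_{m-ξ}. Since β^{m-1}_{m-ξ+1} divides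
-- β^{m-1}_{m-ξ}, they also have the same residue modulo β^{m-1}_{m-ξ+1}, which is (2);
-- (1) is the difference of (2) and the hypothesis.
module Submission where

open import Defs
open import Data.Nat using (ℕ; _≤_; _<_; _∸_)
open import Data.Rational using (ℚ; _-_)
open import Data.Product using (_×_; _,_)
open import Relation.Binary.PropositionalEquality
  using (_≡_; refl; sym; trans; cong; cong₂; subst; module ≡-Reasoning)

open import Data.Nat as ℕ using (zero; suc; s≤s; z≤n)
import Data.Nat.Properties as ℕP
open import Data.Nat.DivMod using (_%_; m%n≡m∸m/n*n; m∣n⇒o%n%m≡o%m; m/n*n≤m)
open import Data.Nat.Divisibility using (_∣_; m∣m*n; 0∣⇒≡0)
open import Data.Integer as ℤ using (+_)
import Data.Integer.Properties as ℤP
open import Data.Rational using (_+_; _*_; -_; fromℚᵘ; ½)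
import Data.Rational.Properties as ℚP
open import Data.Rational.Unnormalised as ℚᵘ using (ℚᵘ; mkℚᵘ; *≡*)
import Data.Rational.Unnormalised.Properties as ℚᵘP
open import Data.Rational.Solver using (module +-*-Solver)
open import Algebra.Properties.Group ℚP.+-0-group using (∙-cancelʳ)
open ≡-Reasoning

fromℚᵘ-homo-+ : ∀ p q → fromℚᵘ (p ℚᵘ.+ q) ≡ fromℚᵘ p + fromℚᵘ q
fromℚᵘ-homo-+ p q = ℚP.toℚᵘ-injective (ℚᵘP.≃-trans (ℚP.toℚᵘ-fromℚᵘ (p ℚᵘ.+ q))
  (ℚᵘP.≃-sym (ℚᵘP.≃-trans (ℚP.toℚᵘ-homo-+ (fromℚᵘ p) (fromℚᵘ q))
    (ℚᵘP.+-cong (ℚP.toℚᵘ-fromℚᵘ p) (ℚP.toℚᵘ-fromℚᵘ q)))))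

-- toℚ n is definitionally fromℚᵘ of the unnormalised fraction n/1.
ℕ→ℚᵘ : ℕ → ℚᵘ
ℕ→ℚᵘ n = mkℚᵘ (+ n) 0

toℚ-injective : ∀ {a b} → toℚ a ≡ toℚ b → a ≡ b
toℚ-injective {a} {b} eq with ℚP.fromℚᵘ-injective {ℕ→ℚᵘ a} {ℕ→ℚᵘ b} eq
... | *≡* a*1≡b*1 = ℤP.+-injective
  (trans (sym (ℤP.*-identityʳ (+ a))) (trans a*1≡b*1 (ℤP.*-identityʳ (+ b))))

toℚ-homo-+ : ∀ a b → toℚ (a ℕ.+ b) ≡ toℚ a + toℚ b
toℚ-homo-+ a b = trans (ℚP.fromℚᵘ-cong {ℕ→ℚᵘ (a ℕ.+ b)} {ℕ→ℚᵘ a ℚᵘ.+ ℕ→ℚᵘ b} (*≡* cross))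
  (fromℚᵘ-homo-+ (ℕ→ℚᵘ a) (ℕ→ℚᵘ b))
  where
  cross : + (a ℕ.+ b) ℤ.* + 1 ≡ (+ a ℤ.* + 1 ℤ.+ + b ℤ.* + 1) ℤ.* + 1
  cross rewrite ℤP.*-identityʳ (+ a) | ℤP.*-identityʳ (+ b) | ℤP.*-identityʳ (+ (a ℕ.+ b)) = refl

-- The remainder of x modulo d, with the convention x mod 0 = x matching divN x 0 = 0.
modN : ℕ → ℕ → ℕ
modN x d = x ∸ divN x d ℕ.* d

divN*≤ : ∀ x d → divN x d ℕ.* d ≤ x
divN*≤ x zero    = z≤n
divN*≤ x (suc d) = m/n*n≤m x (suc d)

modN-suc : ∀ x d → modN x (suc d) ≡ x % suc d
modN-suc x d = sym (m%n≡m∸m/n*n x (suc d))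

modN-divisor : ∀ {d D} x y → d ∣ D → modN x D ≡ modN y D → modN x d ≡ modN y d
modN-divisor {d} {zero} x y _ x≡y = cong (λ z → modN z d) x≡y
modN-divisor {zero} {suc D} x y 0∣D _ with () ← 0∣⇒≡0 0∣D
modN-divisor {suc d} {suc D} x y d∣D eq = begin
  modN x (suc d)          ≡⟨ modN-suc x d ⟩
  x % suc d               ≡⟨ sym (m∣n⇒o%n%m≡o%m (suc d) (suc D) x d∣D) ⟩
  x % suc D % suc d       ≡⟨ cong (_% suc d) (trans (sym (modN-suc x D)) (trans eq (modN-suc y D))) ⟩
  y % suc D % suc d       ≡⟨ m∣n⇒o%n%m≡o%m (suc d) (suc D) y d∣D ⟩
  y % suc d               ≡⟨ modN-suc y d ⟨
  modN y (suc d)          ∎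

prodFrom-+ : ∀ m j n p → prodFrom m j (n ℕ.+ p) ≡ prodFrom m (j ℕ.+ p) n ℕ.* prodFrom m j p
prodFrom-+ m j zero    p = sym (ℕP.*-identityˡ (prodFrom m j p))
prodFrom-+ m j (suc n) p = begin
  4 ℕ.* (m ∸ (j ℕ.+ suc (n ℕ.+ p))) ℕ.* prodFrom m j (n ℕ.+ p)
    ≡⟨ cong₂ (λ k q → 4 ℕ.* (m ∸ k) ℕ.* q) index (prodFrom-+ m j n p) ⟩
  4 ℕ.* (m ∸ (j ℕ.+ p ℕ.+ suc n)) ℕ.* (prodFrom m (j ℕ.+ p) n ℕ.* prodFrom m j p)
    ≡⟨ sym (ℕP.*-assoc (4 ℕ.* (m ∸ (j ℕ.+ p ℕ.+ suc n))) _ _) ⟩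
  prodFrom m (j ℕ.+ p) (suc n) ℕ.* prodFrom m j p
    ∎
  where
  index : j ℕ.+ suc (n ℕ.+ p) ≡ j ℕ.+ p ℕ.+ suc n
  index = begin
    j ℕ.+ suc (n ℕ.+ p)  ≡⟨ cong (λ k → j ℕ.+ suc k) (ℕP.+-comm n p) ⟩
    j ℕ.+ suc (p ℕ.+ n)  ≡⟨ cong (j ℕ.+_) (ℕP.+-suc p n) ⟨
    j ℕ.+ (p ℕ.+ suc n)  ≡⟨ ℕP.+-assoc j p (suc n) ⟨
    j ℕ.+ p ℕ.+ suc n    ∎

β-∣ : ∀ m {j′ j i} → j′ ≤ j → j ≤ i → β m j i ∣ β m j′ i
β-∣ m {j′} {j} {i} j′≤j j≤i = subst (β m j i ∣_) (sym factor) (m∣m*n (β m j′ j))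
  where
  length : i ∸ j′ ≡ (i ∸ j) ℕ.+ (j ∸ j′)
  length = begin
    i ∸ j′                  ≡⟨ cong (_∸ j′) (ℕP.m∸n+n≡m j≤i) ⟨
    (i ∸ j) ℕ.+ j ∸ j′      ≡⟨ ℕP.+-∸-assoc (i ∸ j) j′≤j ⟩
    (i ∸ j) ℕ.+ (j ∸ j′)    ∎
  factor : β m j′ i ≡ β m j i ℕ.* β m j′ j
  factor = begin
    prodFrom m j′ (i ∸ j′)
      ≡⟨ cong (prodFrom m j′) length ⟩
    prodFrom m j′ ((i ∸ j) ℕ.+ (j ∸ j′))
      ≡⟨ prodFrom-+ m j′ (i ∸ j) (j ∸ j′) ⟩
    prodFrom m (j′ ℕ.+ (j ∸ j′)) (i ∸ j) ℕ.* β m j′ j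
      ≡⟨ cong (λ k → prodFrom m k (i ∸ j) ℕ.* β m j′ j) (ℕP.m+[n∸m]≡n j′≤j) ⟩
    β m j i ℕ.* β m j′ j
      ∎

offset-by-residue : ∀ x d (h : ℚ) → toℚ x - (toℚ (divN x d ℕ.* d) + h) ≡ toℚ (modN x d) - h
offset-by-residue x d h = begin
  toℚ x - (q + h)                        ≡⟨ cong (λ y → toℚ y - (q + h)) (ℕP.m∸n+n≡m (divN*≤ x d)) ⟨
  toℚ (modN x d ℕ.+ divN x d ℕ.* d) - (q + h)
                                         ≡⟨ cong (_- (q + h)) (toℚ-homo-+ (modN x d) (divN x d ℕ.* d)) ⟩
  (toℚ (modN x d) + q) - (q + h)         ≡⟨ solve 3 (λ r q h → (r :+ q) :- (q :+ h) := r :- h)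
                                              refl (toℚ (modN x d)) q h ⟩
  toℚ (modN x d) - h                     ∎
  where
  open +-*-Solver
  q = toℚ (divN x d ℕ.* d)

sub-as-difference-of-offsets : ∀ (x p q : ℚ) → p - q ≡ (x - q) - (x - p)
sub-as-difference-of-offsets = solve 3 (λ x p q → p :- q := (x :- q) :- (x :- p)) refl
  where open +-*-Solver

scale : ℕ → ℕ → ℕ
scale m i = β m (m ∸ i) (m ∸ 1)

halfSum : ℕ → ℕ → ℚ
halfSum m i = ½ * toℚ (bsum m i)

scale-∣ : ∀ m k → scale m (suc k) ∣ scale m (suc (suc k))
scale-∣ m k = β-∣ m (ℕP.∸-monoʳ-≤ m (ℕP.n≤1+n (suc k))) (ℕP.∸-monoʳ-≤ m (s≤s z≤n))

π-offset : ∀ m i x → toℚ x - π m i x ≡ toℚ (modN x (scale m i)) - halfSum m i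
π-offset m i x = offset-by-residue x (scale m i) (halfSum m i)

π-offset-injective : ∀ m i x y → toℚ x - π m i x ≡ toℚ y - π m i y →
  modN x (scale m i) ≡ modN y (scale m i)
π-offset-injective m i x y eq = toℚ-injective (∙-cancelʳ (- halfSum m i) _ _
  (trans (sym (π-offset m i x)) (trans eq (π-offset m i y))))

π-offset-cong : ∀ m i x y → modN x (scale m i) ≡ modN y (scale m i) →
  toℚ x - π m i x ≡ toℚ y - π m i y
π-offset-cong m i x y eq = trans (π-offset m i x)
  (trans (cong (λ r → toℚ r - halfSum m i) eq) (sym (π-offset m i y)))

lemma5p6 : (m : ℕ) → 3 ≤ m → (ξ : ℕ) → 1 < ξ → ξ ≤ m → (a a' : ℕ) →
    a < γ* m (m ∸ 1) → a' < γ* m (m ∸ 1) →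
    toℚ a - π m ξ a ≡ toℚ a' - π m ξ a' →
    (π m ξ a - π m (ξ ∸ 1) a ≡ π m ξ a' - π m (ξ ∸ 1) a')
    × (toℚ a - π m (ξ ∸ 1) a ≡ toℚ a' - π m (ξ ∸ 1) a')
lemma5p6 m _ ξ@(suc (suc k)) (s≤s (s≤s _)) _ a a' _ _ hyp = shift , offset
  where
  offset : toℚ a - π m (suc k) a ≡ toℚ a' - π m (suc k) a'
  offset = π-offset-cong m (suc k) a a'
    (modN-divisor a a' (scale-∣ m k) (π-offset-injective m ξ a a' hyp))
  shift : π m ξ a - π m (suc k) a ≡ π m ξ a' - π m (suc k) a'
  shift = begin
    π m ξ a - π m (suc k) a                              ≡⟨ sub-as-difference-of-offsets (toℚ a) _ _ ⟩
    (toℚ a - π m (suc k) a) - (toℚ a - π m ξ a)          ≡⟨ cong₂ _-_ offset hyp ⟩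
    (toℚ a' - π m (suc k) a') - (toℚ a' - π m ξ a')      ≡⟨ sub-as-difference-of-offsets (toℚ a') _ _ ⟨
    π m ξ a' - π m (suc k) a'                            ∎
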